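{- There is an absolute constant $C$ such that for all $b, u \in \mathbb{N}$ and every linear subspace $S$ of $\mathbb{Z}_2^u$ of dimension $b$, \[ \mathbb{E}_{T \in_U \mathcal{L}(u,b)}\big[L(T,S)\big] \le C, \] i.e. this expectation is $O(1)$.
   Context: $\mathbb{Z}_2^n$ denotes the $n$-dimensional vector space over the two-element field. $\mathcal{L}(u,b)$ denotes the set of all linear maps $\mathbb{Z}_2^u \to \mathbb{Z}_2^b$, and the expectation is over a uniformly random $T \in \mathcal{L}(u,b)$. For $S \subseteq \mathbb{Z}_2^u$, $L(T,S) = \max_{\vec y \in \mathbb{Z}_2^b} |T^{ -1}(\vec y) \cap S|$. -}

module Defs where

open import Data.Bool using (Bool; true; false; _xor_; _∧_; if_then_else_)
open import Data.Nat using (ℕ; zero; suc; _+_; _⊔_)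
open import Data.Vec using (Vec; []; _∷_; replicate; zipWith; map)
open import Data.List using (List; []; _∷_; concatMap; foldr; length; filter)
open import Data.Nat.ListAction using (sum)
import Data.List as L
open import Data.Product using (Σ; _×_; _,_)
open import Data.Vec.Properties using (≡-dec)
open import Data.Bool.Properties using () renaming (_≟_ to _≟B_)
open import Relation.Binary.PropositionalEquality using (_≡_)
open import Relation.Nullary using (¬_)
open import Function.Bundles using (_⇔_)

Z2 : ℕ → Set
Z2 n = Vec Bool n

zeroV : (n : ℕ) → Z2 n
zeroV n = replicate n false

_⊕_ : {n : ℕ} → Z2 n → Z2 n → Z2 n
_⊕_ = zipWith _xor_

_≟V_ : {n : ℕ} → (x y : Z2 n) → Relation.Nullary.Dec (x ≡ y)
_≟V_ = ≡-dec _≟B_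

allVec : {A : Set} → List A → (n : ℕ) → List (Vec A n)
allVec xs zero = [] ∷ []
allVec xs (suc n) = concatMap (λ a → L.map (a ∷_) (allVec xs n)) xs

allZ2 : (n : ℕ) → List (Z2 n)
allZ2 n = allVec (true ∷ false ∷ []) n

dot : {n : ℕ} → Z2 n → Z2 n → Bool
dot [] [] = false
dot (a ∷ x) (c ∷ y) = (a ∧ c) xor dot x y

-- A linear map Z_2^u → Z_2^b, represented by its b × u matrix (b rows in Z_2^u).
LinMap : ℕ → ℕ → Set
LinMap u b = Vec (Z2 u) b

apply : {u b : ℕ} → LinMap u b → Z2 u → Z2 b
apply T x = map (λ row → dot row x) T

-- 𝓛(u,b): the list of all linear maps Z_2^u → Z_2^b (each exactly once)
allLin : (u b : ℕ) → List (LinMap u b)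
allLin u b = allVec (allZ2 u) b

Subset2 : ℕ → Set
Subset2 u = Z2 u → Bool

combo : {u b : ℕ} → Vec (Z2 u) b → Z2 b → Z2 u
combo {u} [] [] = zeroV u
combo (v ∷ vs) (c ∷ cs) = (if c then v else zeroV _) ⊕ combo vs cs

IsSubspace : {u : ℕ} → Subset2 u → Set
IsSubspace {u} S = (S (zeroV u) ≡ true) × (∀ x y → S x ≡ true → S y ≡ true → S (x ⊕ y) ≡ true)

IsBasis : {u b : ℕ} → Subset2 u → Vec (Z2 u) b → Set
IsBasis {u} {b} S B =
  (∀ c → combo B c ≡ zeroV u → c ≡ zeroV b) ×
  (∀ x → (S x ≡ true) ⇔ Σ (Z2 b) (λ c → combo B c ≡ x))

IsSubspaceOfDim : {u : ℕ} → Subset2 u → ℕ → Set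
IsSubspaceOfDim {u} S b = IsSubspace S × Σ (Vec (Z2 u) b) (λ B → IsBasis S B)

fiberCount : {u b : ℕ} → LinMap u b → Subset2 u → Z2 b → ℕ
fiberCount {u} T S y =
  length (filter (λ x → apply T x ≟V y) (filter (λ x → S x ≟B true) (allZ2 u)))

Lmax : {u b : ℕ} → LinMap u b → Subset2 u → ℕ
Lmax {u} {b} T S = foldr (λ y m → fiberCount T S y ⊔ m) 0 (allZ2 b)

-- Σ_{T ∈ 𝓛(u,b)} L(T,S)   (the expectation times |𝓛(u,b)|)
sumL : (u b : ℕ) → Subset2 u → ℕ
sumL u b S = sum (L.map (λ T → Lmax T S) (allLin u b))

module Submission where

-- For a linear map T and a subspace S of Z₂ᵘ, every non-empty fibre T⁻¹(y) ∩ S is a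
-- translate of a subset of ker T ∩ S, so L(T,S) ≤ |ker T ∩ S|.  Counting pairs
-- (T, x) with x ∈ S and T x = 0 the other way round gives
--     Σ_T L(T,S)  ≤  Σ_{x ∈ S} #{T : T x = 0}.
-- The zero vector is killed by all |𝓛(u,b)| maps.  For x ≠ 0 exactly half of all row
-- vectors r satisfy r·x = 0, so #{T : T x = 0} = (2ᵘ⁻¹)ᵇ = |𝓛(u,b)| / 2ᵇ; as |S| ≤ 2ᵇ
-- the nonzero x contribute at most |𝓛(u,b)|.  Hence Σ_T L(T,S) ≤ 2·|𝓛(u,b)|, i.e. C = 2.
-- To stay in ℕ the last step is proved after multiplying by 2ᵇ and then cancelled.

open import Defs
open import Data.Nat using (ℕ; _*_; _≤_)
open import Data.List using (length)
open import Data.Product using (Σ)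

open import Data.Nat using (zero; suc; _+_; _⊔_; _^_; z≤n)
open import Data.Nat.Properties
open import Data.Nat.ListAction using (sum)
open import Data.Bool using (Bool; true; false; _xor_; _∧_; if_then_else_)
open import Data.Bool.Properties
  using (∧-conicalˡ; ∧-conicalʳ; xor-same; xor-assoc; xor-identityʳ; ∧-distribˡ-xor; ∧-distribʳ-xor; xor-∧-commutativeRing)
  renaming (_≟_ to _≟B_)
open import Data.Vec using (Vec; []; _∷_)
open import Data.Vec.Properties using (zipWith-assoc; zipWith-identityʳ)
open import Data.List as L using (List; []; _∷_; _++_; concatMap; filter; foldr)
open import Data.Product using (_,_; proj₁; proj₂; ∃)
open import Relation.Nullary using (yes; no; does; ¬_)
open import Relation.Unary using (Pred; Decidable)
open import Relation.Binary.PropositionalEquality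
open import Function.Bundles using (Equivalence)
open import Data.Empty using (⊥-elim)
open import Level using (Level)
open import Algebra.Bundles using (CommutativeRing)
open import Algebra.Properties.CommutativeSemigroup
  (CommutativeRing.+-commutativeSemigroup xor-∧-commutativeRing) using () renaming (interchange to xor-interchange)
open import Algebra.Properties.CommutativeSemigroup +-commutativeSemigroup
  using () renaming (interchange to +-interchange)

∑ : {A : Set} → List A → (A → ℕ) → ℕ
∑ xs f = sum (L.map f xs)

syntax ∑ xs (λ x → e) = ∑[ x ∈ xs ] e

𝟙 : Bool → ℕ
𝟙 b = if b then 1 else 0

𝟙≤1 : ∀ c → 𝟙 c ≤ 1
𝟙≤1 true = ≤-refl
𝟙≤1 false = z≤n

𝟙-∧ : ∀ c d → 𝟙 (c ∧ d) ≡ 𝟙 c * 𝟙 d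
𝟙-∧ true d = sym (+-identityʳ (𝟙 d))
𝟙-∧ false d = refl

module _ {A : Set} where

  ∑-cong : {f g : A → ℕ} (xs : List A) → (∀ x → f x ≡ g x) → ∑ xs f ≡ ∑ xs g
  ∑-cong [] e = refl
  ∑-cong (x ∷ xs) e = cong₂ _+_ (e x) (∑-cong xs e)

  ∑-mono : {f g : A → ℕ} (xs : List A) → (∀ x → f x ≤ g x) → ∑ xs f ≤ ∑ xs g
  ∑-mono [] e = z≤n
  ∑-mono (x ∷ xs) e = +-mono-≤ (e x) (∑-mono xs e)

  ∑-zero : (xs : List A) → ∑[ x ∈ xs ] 0 ≡ 0
  ∑-zero [] = refl
  ∑-zero (x ∷ xs) = ∑-zero xs

  ∑-++ : (f : A → ℕ) (xs ys : List A) → ∑ (xs ++ ys) f ≡ ∑ xs f + ∑ ys f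
  ∑-++ f [] ys = refl
  ∑-++ f (x ∷ xs) ys = trans (cong (f x +_) (∑-++ f xs ys)) (sym (+-assoc (f x) _ _))

  ∑-+ : (f g : A → ℕ) (xs : List A) → ∑[ x ∈ xs ] (f x + g x) ≡ ∑ xs f + ∑ xs g
  ∑-+ f g [] = refl
  ∑-+ f g (x ∷ xs) = begin
    f x + g x + ∑[ x ∈ xs ] (f x + g x) ≡⟨ cong (f x + g x +_) (∑-+ f g xs) ⟩
    f x + g x + (∑ xs f + ∑ xs g)       ≡⟨ +-interchange (f x) (g x) (∑ xs f) (∑ xs g) ⟩
    f x + ∑ xs f + (g x + ∑ xs g)       ∎
    where open ≡-Reasoning

  ∑-*ʳ : (f : A → ℕ) (k : ℕ) (xs : List A) → ∑[ x ∈ xs ] (f x * k) ≡ ∑ xs f * k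
  ∑-*ʳ f k [] = refl
  ∑-*ʳ f k (x ∷ xs) = trans (cong (f x * k +_) (∑-*ʳ f k xs)) (sym (*-distribʳ-+ k (f x) (∑ xs f)))

  ∑-*ˡ : (k : ℕ) (f : A → ℕ) (xs : List A) → ∑[ x ∈ xs ] (k * f x) ≡ k * ∑ xs f
  ∑-*ˡ k f xs = trans (∑-cong xs (λ x → *-comm k (f x))) (trans (∑-*ʳ f k xs) (*-comm (∑ xs f) k))

  ∑-const : (k : ℕ) (xs : List A) → ∑[ x ∈ xs ] k ≡ length xs * k
  ∑-const k [] = refl
  ∑-const k (x ∷ xs) = cong (k +_) (∑-const k xs)

  length-as-∑ : (xs : List A) → length xs ≡ ∑[ x ∈ xs ] 1
  length-as-∑ xs = trans (sym (*-identityʳ (length xs))) (sym (∑-const 1 xs))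

  ∑-filter : {ℓ : Level} {P : Pred A ℓ} (P? : Decidable P) (f : A → ℕ) (xs : List A) →
    ∑ (filter P? xs) f ≡ ∑[ x ∈ xs ] (if does (P? x) then f x else 0)
  ∑-filter P? f [] = refl
  ∑-filter P? f (x ∷ xs) with does (P? x)
  ... | true = cong (f x +_) (∑-filter P? f xs)
  ... | false = ∑-filter P? f xs

  ∑-𝟙-witness : (p : A → Bool) (xs : List A) (n : ℕ) → ∑[ x ∈ xs ] 𝟙 (p x) ≡ suc n → ∃ λ x → p x ≡ true
  ∑-𝟙-witness p [] n ()
  ∑-𝟙-witness p (x ∷ xs) n e with p x in px
  ... | true = x , px
  ... | false = ∑-𝟙-witness p xs n e

∑-swap : {A B : Set} (f : A → B → ℕ) (xs : List A) (ys : List B) →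
  ∑[ x ∈ xs ] ∑ ys (f x) ≡ ∑[ y ∈ ys ] ∑[ x ∈ xs ] f x y
∑-swap f [] ys = sym (∑-zero ys)
∑-swap f (x ∷ xs) ys = trans (cong (∑ ys (f x) +_) (∑-swap f xs ys))
  (sym (∑-+ (f x) (λ y → ∑[ x ∈ xs ] f x y) ys))

∑-map : {A B : Set} (f : B → ℕ) (g : A → B) (xs : List A) → ∑ (L.map g xs) f ≡ ∑[ x ∈ xs ] f (g x)
∑-map f g [] = refl
∑-map f g (x ∷ xs) = cong (f (g x) +_) (∑-map f g xs)

∑-concatMap : {A B : Set} (f : B → ℕ) (g : A → List B) (xs : List A) →
  ∑ (concatMap g xs) f ≡ ∑[ x ∈ xs ] ∑ (g x) f
∑-concatMap f g [] = refl
∑-concatMap f g (x ∷ xs) = trans (∑-++ f (g x) (concatMap g xs)) (cong (∑ (g x) f +_) (∑-concatMap f g xs))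

∑-allVec-suc : {A : Set} (xs : List A) (n : ℕ) (f : Vec A (suc n) → ℕ) →
  ∑ (allVec xs (suc n)) f ≡ ∑[ a ∈ xs ] ∑[ v ∈ allVec xs n ] f (a ∷ v)
∑-allVec-suc xs n f = trans (∑-concatMap f _ xs) (∑-cong xs (λ a → ∑-map f (a ∷_) (allVec xs n)))

∑-Z2-suc : (n : ℕ) (f : Z2 (suc n) → ℕ) →
  ∑ (allZ2 (suc n)) f ≡ ∑[ x ∈ allZ2 n ] f (true ∷ x) + ∑[ x ∈ allZ2 n ] f (false ∷ x)
∑-Z2-suc n f = trans (∑-allVec-suc (true ∷ false ∷ []) n f) (cong (∑[ x ∈ allZ2 n ] f (true ∷ x) +_) (+-identityʳ _))

length-allVec : {A : Set} (xs : List A) (n : ℕ) → length (allVec xs n) ≡ length xs ^ n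
length-allVec xs zero = refl
length-allVec xs (suc n) = begin
  length (allVec xs (suc n))                 ≡⟨ length-as-∑ (allVec xs (suc n)) ⟩
  ∑[ v ∈ allVec xs (suc n) ] 1               ≡⟨ ∑-allVec-suc xs n (λ _ → 1) ⟩
  ∑[ a ∈ xs ] ∑[ v ∈ allVec xs n ] 1         ≡⟨ ∑-cong xs (λ _ → sym (length-as-∑ (allVec xs n))) ⟩
  ∑[ a ∈ xs ] length (allVec xs n)           ≡⟨ ∑-cong xs (λ _ → length-allVec xs n) ⟩
  ∑[ a ∈ xs ] (length xs ^ n)                ≡⟨ ∑-const (length xs ^ n) xs ⟩
  length xs * length xs ^ n                  ∎
  where open ≡-Reasoning

length-allZ2 : (n : ℕ) → length (allZ2 n) ≡ 2 ^ n
length-allZ2 = length-allVec (true ∷ false ∷ [])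

∑-translate : (n : ℕ) (a : Z2 n) (f : Z2 n → ℕ) → ∑ (allZ2 n) f ≡ ∑[ x ∈ allZ2 n ] f (x ⊕ a)
∑-translate zero [] f = refl
∑-translate (suc n) (c ∷ a) f = begin
  ∑ (allZ2 (suc n)) f
    ≡⟨ ∑-Z2-suc n f ⟩
  ∑[ x ∈ allZ2 n ] f (true ∷ x) + ∑[ x ∈ allZ2 n ] f (false ∷ x)
    ≡⟨ cong₂ _+_ (∑-translate n a (λ x → f (true ∷ x))) (∑-translate n a (λ x → f (false ∷ x))) ⟩
  ∑[ x ∈ allZ2 n ] f (true ∷ (x ⊕ a)) + ∑[ x ∈ allZ2 n ] f (false ∷ (x ⊕ a))
    ≡⟨ flip-first c ⟩
  ∑[ x ∈ allZ2 n ] f ((true xor c) ∷ (x ⊕ a)) + ∑[ x ∈ allZ2 n ] f ((false xor c) ∷ (x ⊕ a))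
    ≡⟨ sym (∑-Z2-suc n (λ x → f (x ⊕ (c ∷ a)))) ⟩
  ∑[ x ∈ allZ2 (suc n) ] f (x ⊕ (c ∷ a))
    ∎
  where
  open ≡-Reasoning
  -- adding c to the first coordinate either fixes or swaps the two halves
  flip-first : ∀ c → ∑[ x ∈ allZ2 n ] f (true ∷ (x ⊕ a)) + ∑[ x ∈ allZ2 n ] f (false ∷ (x ⊕ a))
                   ≡ ∑[ x ∈ allZ2 n ] f ((true xor c) ∷ (x ⊕ a)) + ∑[ x ∈ allZ2 n ] f ((false xor c) ∷ (x ⊕ a))
  flip-first true = +-comm (∑[ x ∈ allZ2 n ] f (true ∷ (x ⊕ a))) _
  flip-first false = refl

term≤∑ : (n : ℕ) (c : Z2 n) (f : Z2 n → ℕ) → f c ≤ ∑ (allZ2 n) f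
term≤∑ zero [] f = m≤m+n (f []) 0
term≤∑ (suc n) (true ∷ c) f rewrite ∑-Z2-suc n f = ≤-trans (term≤∑ n c (λ x → f (true ∷ x))) (m≤m+n _ _)
term≤∑ (suc n) (false ∷ c) f rewrite ∑-Z2-suc n f = ≤-trans (term≤∑ n c (λ x → f (false ∷ x))) (m≤n+m _ _)

_==_ : {n : ℕ} → Z2 n → Z2 n → Bool
x == y = does (x ≟V y)

==-sound : {n : ℕ} (x y : Z2 n) → x == y ≡ true → x ≡ y
==-sound x y x==y with x ≟V y
... | yes x≡y = x≡y

∑-point : (n : ℕ) (a : Z2 n) → ∑[ x ∈ allZ2 n ] 𝟙 (x == a) ≡ 1
∑-point zero [] = refl
∑-point (suc n) (true ∷ a) rewrite ∑-Z2-suc n (λ x → 𝟙 (x == (true ∷ a))) | ∑-point n a = cong suc (∑-zero (allZ2 n))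
∑-point (suc n) (false ∷ a) rewrite ∑-Z2-suc n (λ x → 𝟙 (x == (false ∷ a))) | ∑-point n a = cong (_+ 1) (∑-zero (allZ2 n))

dot-linearʳ : ∀ {n} (r x y : Z2 n) → dot r (x ⊕ y) ≡ dot r x xor dot r y
dot-linearʳ [] [] [] = refl
dot-linearʳ (a ∷ r) (x ∷ xs) (y ∷ ys) = begin
  (a ∧ (x xor y)) xor dot r (xs ⊕ ys)                 ≡⟨ cong₂ _xor_ (∧-distribˡ-xor a x y) (dot-linearʳ r xs ys) ⟩
  ((a ∧ x) xor (a ∧ y)) xor (dot r xs xor dot r ys)   ≡⟨ xor-interchange (a ∧ x) (a ∧ y) (dot r xs) (dot r ys) ⟩
  ((a ∧ x) xor dot r xs) xor ((a ∧ y) xor dot r ys)   ∎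
  where open ≡-Reasoning

dot-linearˡ : ∀ {n} (r e x : Z2 n) → dot (r ⊕ e) x ≡ dot r x xor dot e x
dot-linearˡ [] [] [] = refl
dot-linearˡ (a ∷ r) (c ∷ e) (x ∷ xs) = begin
  ((a xor c) ∧ x) xor dot (r ⊕ e) xs                  ≡⟨ cong₂ _xor_ (∧-distribʳ-xor x a c) (dot-linearˡ r e xs) ⟩
  ((a ∧ x) xor (c ∧ x)) xor (dot r xs xor dot e xs)   ≡⟨ xor-interchange (a ∧ x) (c ∧ x) (dot r xs) (dot e xs) ⟩
  ((a ∧ x) xor dot r xs) xor ((c ∧ x) xor dot e xs)   ∎
  where open ≡-Reasoning

apply-linear : ∀ {u b} (T : LinMap u b) (x y : Z2 u) → apply T (x ⊕ y) ≡ apply T x ⊕ apply T y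
apply-linear [] x y = refl
apply-linear (r ∷ T) x y = cong₂ _∷_ (dot-linearʳ r x y) (apply-linear T x y)

dot-zeroˡ : ∀ n (x : Z2 n) → dot (zeroV n) x ≡ false
dot-zeroˡ zero [] = refl
dot-zeroˡ (suc n) (x ∷ xs) = dot-zeroˡ n xs

⊕-self : ∀ {n} (y : Z2 n) → y ⊕ y ≡ zeroV n
⊕-self [] = refl
⊕-self (c ∷ ys) = cong₂ _∷_ (xor-same c) (⊕-self ys)

⊕-cancelʳ : ∀ {n} (x y : Z2 n) → (x ⊕ y) ⊕ y ≡ x
⊕-cancelʳ {n} x y = begin
  (x ⊕ y) ⊕ y   ≡⟨ zipWith-assoc xor-assoc x y y ⟩
  x ⊕ (y ⊕ y)   ≡⟨ cong (x ⊕_) (⊕-self y) ⟩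
  x ⊕ zeroV n   ≡⟨ zipWith-identityʳ xor-identityʳ x ⟩
  x             ∎
  where open ≡-Reasoning

same-image⇒kernel : ∀ {u b} (T : LinMap u b) (x x₀ : Z2 u) {y : Z2 b} →
  apply T (x ⊕ x₀) ≡ y → apply T x₀ ≡ y → apply T x ≡ zeroV b
same-image⇒kernel {b = b} T x x₀ {y} T[x⊕x₀]≡y Tx₀≡y = begin
  apply T x                        ≡⟨ cong (apply T) (sym (⊕-cancelʳ x x₀)) ⟩
  apply T ((x ⊕ x₀) ⊕ x₀)          ≡⟨ apply-linear T (x ⊕ x₀) x₀ ⟩
  apply T (x ⊕ x₀) ⊕ apply T x₀    ≡⟨ cong₂ _⊕_ T[x⊕x₀]≡y Tx₀≡y ⟩
  y ⊕ y                            ≡⟨ ⊕-self y ⟩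
  zeroV b                          ∎
  where open ≡-Reasoning

fibre : ∀ {u b} → LinMap u b → Subset2 u → Z2 b → ℕ
fibre {u} T S y = ∑[ x ∈ allZ2 u ] 𝟙 (S x ∧ apply T x == y)

fiberCount≡fibre : ∀ {u b} (T : LinMap u b) S y → fiberCount T S y ≡ fibre T S y
fiberCount≡fibre {u} T S y = begin
  length (filter Q? (filter S? (allZ2 u)))                 ≡⟨ length-as-∑ (filter Q? (filter S? (allZ2 u))) ⟩
  ∑ (filter Q? (filter S? (allZ2 u))) (λ _ → 1)            ≡⟨ ∑-filter Q? (λ _ → 1) (filter S? (allZ2 u)) ⟩
  ∑ (filter S? (allZ2 u)) (λ x → 𝟙 (apply T x == y))       ≡⟨ ∑-filter S? (λ x → 𝟙 (apply T x == y)) (allZ2 u) ⟩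
  ∑[ x ∈ allZ2 u ] (if does (S? x) then 𝟙 (apply T x == y) else 0)
                                                          ≡⟨ ∑-cong (allZ2 u) (λ x → filters-as-∧ (S x)) ⟩
  fibre T S y                                             ∎
  where
  open ≡-Reasoning
  S? = λ x → S x ≟B true
  Q? = λ x → apply T x ≟V y
  filters-as-∧ : ∀ {x} s → (if does (s ≟B true) then 𝟙 (apply T x == y) else 0) ≡ 𝟙 (s ∧ apply T x == y)
  filters-as-∧ true = refl
  filters-as-∧ false = refl

-- On a subspace, every fibre is a translate of (a subset of) the kernel fibre:
-- if x₀ ∈ S maps to y, then x ↦ x ⊕ x₀ sends T⁻¹(y) ∩ S into ker T ∩ S.
fibre≤kernel : ∀ {u b} (S : Subset2 u) → IsSubspace S → (T : LinMap u b) (y : Z2 b) →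
  fibre T S y ≤ fibre T S (zeroV b)
fibre≤kernel {u} {b} S (_ , S-closed) T y with fibre T S y in fibre≡
... | zero = z≤n
... | suc n with ∑-𝟙-witness (λ x → S x ∧ apply T x == y) (allZ2 u) n fibre≡
... | x₀ , x₀∈fibre = begin
    suc n                                                       ≡⟨ sym fibre≡ ⟩
    fibre T S y                                                 ≡⟨ ∑-translate u x₀ _ ⟩
    ∑[ x ∈ allZ2 u ] 𝟙 (S (x ⊕ x₀) ∧ apply T (x ⊕ x₀) == y)     ≤⟨ ∑-mono (allZ2 u) shift-into-kernel ⟩
    fibre T S (zeroV b)                                         ∎
  where
  open ≤-Reasoning
  x₀∈S : S x₀ ≡ true
  x₀∈S = ∧-conicalˡ _ _ x₀∈fibre
  Tx₀≡y : apply T x₀ ≡ y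
  Tx₀≡y = ==-sound (apply T x₀) y (∧-conicalʳ (S x₀) _ x₀∈fibre)
  -- if x ⊕ x₀ ∈ S and T (x ⊕ x₀) = y, then x = (x ⊕ x₀) ⊕ x₀ ∈ S and T x = y ⊕ y = 0
  shifted∈S : ∀ x → S (x ⊕ x₀) ≡ true → S x ≡ true
  shifted∈S x x⊕x₀∈S = subst (λ z → S z ≡ true) (⊕-cancelʳ x x₀) (S-closed (x ⊕ x₀) x₀ x⊕x₀∈S x₀∈S)
  in-kernel-fibre : ∀ {x} → S x ≡ true → apply T x ≡ zeroV b → 1 ≤ 𝟙 (S x ∧ apply T x == zeroV b)
  in-kernel-fibre {x} x∈S Tx≡0 rewrite x∈S with apply T x ≟V zeroV b
  ... | yes _ = ≤-refl
  ... | no Tx≢0 = ⊥-elim (Tx≢0 Tx≡0)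
  shift-into-kernel : ∀ x → 𝟙 (S (x ⊕ x₀) ∧ apply T (x ⊕ x₀) == y) ≤ 𝟙 (S x ∧ apply T x == zeroV b)
  shift-into-kernel x with S (x ⊕ x₀) in x⊕x₀∈S | apply T (x ⊕ x₀) ≟V y
  ... | false | _ = z≤n
  ... | true | no _ = z≤n
  ... | true | yes T[x⊕x₀]≡y = in-kernel-fibre (shifted∈S x x⊕x₀∈S) (same-image⇒kernel T x x₀ T[x⊕x₀]≡y Tx₀≡y)

Lmax≤kernel : ∀ {u b} (S : Subset2 u) → IsSubspace S → (T : LinMap u b) → Lmax T S ≤ fibre T S (zeroV b)
Lmax≤kernel {u} {b} S sub T = foldr-lub (allZ2 b)
  where
  foldr-lub : (ys : List (Z2 b)) → foldr (λ y m → fiberCount T S y ⊔ m) 0 ys ≤ fibre T S (zeroV b)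
  foldr-lub [] = z≤n
  foldr-lub (y ∷ ys) = ⊔-lub (≤-trans (≤-reflexive (fiberCount≡fibre T S y)) (fibre≤kernel S sub T y)) (foldr-lub ys)

killers : ∀ u b → Z2 u → ℕ
killers u b x = ∑[ T ∈ allLin u b ] 𝟙 (apply T x == zeroV b)

orthogonals : ∀ u → Z2 u → ℕ
orthogonals u x = ∑[ r ∈ allZ2 u ] 𝟙 (does (dot r x ≟B false))

length-allLin : ∀ u b → length (allLin u b) ≡ (2 ^ u) ^ b
length-allLin u b = trans (length-allVec (allZ2 u) b) (cong (_^ b) (length-allZ2 u))

killers≤all : ∀ u b x → killers u b x ≤ length (allLin u b)
killers≤all u b x = subst (killers u b x ≤_) (sym (length-as-∑ (allLin u b))) (∑-mono (allLin u b) (λ T → 𝟙≤1 _))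

-- T x = 0 iff each of the b rows of T is orthogonal to x, and the rows are independent.
killers≡orthogonals^b : ∀ u b x → killers u b x ≡ orthogonals u x ^ b
killers≡orthogonals^b u zero x = refl
killers≡orthogonals^b u (suc b) x = begin
  killers u (suc b) x
    ≡⟨ ∑-allVec-suc (allZ2 u) b (λ T → 𝟙 (apply T x == zeroV (suc b))) ⟩
  ∑[ r ∈ allZ2 u ] ∑[ T ∈ allLin u b ] 𝟙 (does (dot r x ≟B false) ∧ apply T x == zeroV b)
    ≡⟨ ∑-cong (allZ2 u) (λ r → ∑-cong (allLin u b) (λ T → 𝟙-∧ (does (dot r x ≟B false)) _)) ⟩
  ∑[ r ∈ allZ2 u ] ∑[ T ∈ allLin u b ] (𝟙 (does (dot r x ≟B false)) * 𝟙 (apply T x == zeroV b))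
    ≡⟨ ∑-cong (allZ2 u) (λ r → ∑-*ˡ (𝟙 (does (dot r x ≟B false))) _ (allLin u b)) ⟩
  ∑[ r ∈ allZ2 u ] (𝟙 (does (dot r x ≟B false)) * killers u b x)
    ≡⟨ ∑-*ʳ _ (killers u b x) (allZ2 u) ⟩
  orthogonals u x * killers u b x
    ≡⟨ cong (orthogonals u x *_) (killers≡orthogonals^b u b x) ⟩
  orthogonals u x ^ suc b ∎
  where open ≡-Reasoning

nonorthogonal : ∀ n (x : Z2 n) → ¬ (x ≡ zeroV n) → ∃ λ e → dot e x ≡ true
nonorthogonal zero [] x≢0 = ⊥-elim (x≢0 refl)
nonorthogonal (suc n) (true ∷ x) x≢0 = (true ∷ zeroV n) , cong (true xor_) (dot-zeroˡ n x)
nonorthogonal (suc n) (false ∷ x) x≢0 with nonorthogonal n x (λ x≡0 → x≢0 (cong (false ∷_) x≡0))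
... | e , e·x≡1 = (false ∷ e) , e·x≡1

-- For x ≠ 0 exactly half of Z₂ᵘ is orthogonal to x: r ↦ r ⊕ e with e·x = 1 exchanges
-- the vectors orthogonal and non-orthogonal to x.
orthogonals-half : ∀ u (x : Z2 u) → ¬ (x ≡ zeroV u) → 2 * orthogonals u x ≡ 2 ^ u
orthogonals-half u x x≢0 = begin
  orthogonals u x + (orthogonals u x + 0)    ≡⟨ cong (orthogonals u x +_) (+-identityʳ _) ⟩
  orthogonals u x + orthogonals u x          ≡⟨ cong (orthogonals u x +_) orthogonals≡nonorthogonals ⟩
  orthogonals u x + nonorthogonals           ≡⟨ sym (∑-+ _ _ (allZ2 u)) ⟩
  ∑[ r ∈ allZ2 u ] (𝟙 (does (dot r x ≟B false)) + 𝟙 (dot r x))  ≡⟨ ∑-cong (allZ2 u) (λ r → one-or-other (dot r x)) ⟩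
  ∑[ r ∈ allZ2 u ] 1                         ≡⟨ sym (length-as-∑ (allZ2 u)) ⟩
  length (allZ2 u)                           ≡⟨ length-allZ2 u ⟩
  2 ^ u                                      ∎
  where
  open ≡-Reasoning
  e = proj₁ (nonorthogonal u x x≢0)
  nonorthogonals = ∑[ r ∈ allZ2 u ] 𝟙 (dot r x)
  one-or-other : ∀ c → 𝟙 (does (c ≟B false)) + 𝟙 c ≡ 1
  one-or-other true = refl
  one-or-other false = refl
  flip : ∀ r → 𝟙 (does (dot (r ⊕ e) x ≟B false)) ≡ 𝟙 (dot r x)
  flip r rewrite dot-linearˡ r e x | proj₂ (nonorthogonal u x x≢0) with dot r x
  ... | true = refl
  ... | false = refl
  orthogonals≡nonorthogonals : orthogonals u x ≡ nonorthogonals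
  orthogonals≡nonorthogonals = trans (∑-translate u e _) (∑-cong (allZ2 u) flip)

*-^-distrib : ∀ a c b → (a * c) ^ b ≡ a ^ b * c ^ b
*-^-distrib a c zero = refl
*-^-distrib a c (suc b) =
  trans (cong (a * c *_) (*-^-distrib a c b)) ([m*n]*[o*p]≡[m*o]*[n*p] a c (a ^ b) (c ^ b))

killers-nonzero : ∀ u b (x : Z2 u) → ¬ (x ≡ zeroV u) → 2 ^ b * killers u b x ≡ length (allLin u b)
killers-nonzero u b x x≢0 = begin
  2 ^ b * killers u b x                ≡⟨ cong (2 ^ b *_) (killers≡orthogonals^b u b x) ⟩
  2 ^ b * orthogonals u x ^ b          ≡⟨ sym (*-^-distrib 2 (orthogonals u x) b) ⟩
  (2 * orthogonals u x) ^ b            ≡⟨ cong (_^ b) (orthogonals-half u x x≢0) ⟩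
  (2 ^ u) ^ b                          ≡⟨ sym (length-allLin u b) ⟩
  length (allLin u b)                  ∎
  where open ≡-Reasoning

-- A subspace with a basis of b vectors has at most 2ᵇ elements: each element is the
-- image of some coefficient vector c ∈ Z₂ᵇ.
subspace-size : ∀ {u b} (S : Subset2 u) (B : Vec (Z2 u) b) → IsBasis S B → ∑[ x ∈ allZ2 u ] 𝟙 (S x) ≤ 2 ^ b
subspace-size {u} {b} S B (_ , spans) = begin
  ∑[ x ∈ allZ2 u ] 𝟙 (S x)                                  ≤⟨ ∑-mono (allZ2 u) covered ⟩
  ∑[ x ∈ allZ2 u ] ∑[ c ∈ allZ2 b ] 𝟙 (x == combo B c)
    ≡⟨ ∑-swap (λ x c → 𝟙 (x == combo B c)) (allZ2 u) (allZ2 b) ⟩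
  ∑[ c ∈ allZ2 b ] ∑[ x ∈ allZ2 u ] 𝟙 (x == combo B c)      ≡⟨ ∑-cong (allZ2 b) (λ c → ∑-point u (combo B c)) ⟩
  ∑[ c ∈ allZ2 b ] 1                                        ≡⟨ sym (length-as-∑ (allZ2 b)) ⟩
  length (allZ2 b)                                          ≡⟨ length-allZ2 b ⟩
  2 ^ b                                                     ∎
  where
  open ≤-Reasoning
  hit : ∀ {x} c → combo B c ≡ x → 1 ≤ 𝟙 (x == combo B c)
  hit {x} c combo≡x with x ≟V combo B c
  ... | yes _ = ≤-refl
  ... | no x≢combo = ⊥-elim (x≢combo (sym combo≡x))
  covered : ∀ x → 𝟙 (S x) ≤ ∑[ c ∈ allZ2 b ] 𝟙 (x == combo B c)
  covered x with S x in x∈S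
  ... | false = z≤n
  ... | true with Equivalence.to (spans x) x∈S
  ... | c , combo≡x = ≤-trans (hit c combo≡x) (term≤∑ b c (λ c → 𝟙 (x == combo B c)))

sumL≤∑killers : ∀ u b (S : Subset2 u) → IsSubspace S →
  sumL u b S ≤ ∑[ x ∈ allZ2 u ] (𝟙 (S x) * killers u b x)
sumL≤∑killers u b S sub = begin
  ∑[ T ∈ allLin u b ] Lmax T S                                        ≤⟨ ∑-mono (allLin u b) (Lmax≤kernel S sub) ⟩
  ∑[ T ∈ allLin u b ] fibre T S (zeroV b)                              ≡⟨ ∑-swap _ (allLin u b) (allZ2 u) ⟩
  ∑[ x ∈ allZ2 u ] ∑[ T ∈ allLin u b ] 𝟙 (S x ∧ apply T x == zeroV b)
    ≡⟨ ∑-cong (allZ2 u) (λ x → ∑-cong (allLin u b) (λ T → 𝟙-∧ (S x) _)) ⟩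
  ∑[ x ∈ allZ2 u ] ∑[ T ∈ allLin u b ] (𝟙 (S x) * 𝟙 (apply T x == zeroV b))
    ≡⟨ ∑-cong (allZ2 u) (λ x → ∑-*ˡ (𝟙 (S x)) _ (allLin u b)) ⟩
  ∑[ x ∈ allZ2 u ] (𝟙 (S x) * killers u b x)                          ∎
  where open ≤-Reasoning

-- Pointwise, after scaling by 2ᵇ: x = 0 contributes at most 2ᵇ·|𝓛|, each nonzero x ∈ S exactly |𝓛|.
scaled-killers-bound : ∀ u b (S : Subset2 u) (x : Z2 u) →
  2 ^ b * (𝟙 (S x) * killers u b x) ≤ 2 ^ b * (𝟙 (x == zeroV u) * length (allLin u b)) + 𝟙 (S x) * length (allLin u b)
scaled-killers-bound u b S x with S x | x ≟V zeroV u
... | false | _ = ≤-trans (≤-reflexive (*-zeroʳ (2 ^ b))) z≤n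
... | true | yes _ rewrite *-identityˡ (killers u b x) | *-identityˡ (length (allLin u b)) =
  ≤-trans (*-monoʳ-≤ (2 ^ b) (killers≤all u b x)) (m≤m+n _ _)
... | true | no x≢0 rewrite *-identityˡ (killers u b x) | *-identityˡ (length (allLin u b)) =
  ≤-trans (≤-reflexive (killers-nonzero u b x x≢0)) (m≤n+m _ _)

scaled-∑killers-bound : ∀ u b (S : Subset2 u) → ∑[ x ∈ allZ2 u ] 𝟙 (S x) ≤ 2 ^ b →
  2 ^ b * ∑[ x ∈ allZ2 u ] (𝟙 (S x) * killers u b x) ≤ 2 ^ b * (2 * length (allLin u b))
scaled-∑killers-bound u b S |S|≤2^b = begin
  2 ^ b * ∑[ x ∈ allZ2 u ] (𝟙 (S x) * killers u b x)
    ≡⟨ sym (∑-*ˡ (2 ^ b) _ (allZ2 u)) ⟩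
  ∑[ x ∈ allZ2 u ] (2 ^ b * (𝟙 (S x) * killers u b x))
    ≤⟨ ∑-mono (allZ2 u) (scaled-killers-bound u b S) ⟩
  ∑[ x ∈ allZ2 u ] (2 ^ b * (𝟙 (x == zeroV u) * K) + 𝟙 (S x) * K)
    ≡⟨ ∑-+ _ _ (allZ2 u) ⟩
  ∑[ x ∈ allZ2 u ] (2 ^ b * (𝟙 (x == zeroV u) * K)) + ∑[ x ∈ allZ2 u ] (𝟙 (S x) * K)
    ≡⟨ cong₂ _+_ (trans (∑-*ˡ (2 ^ b) _ (allZ2 u)) (cong (2 ^ b *_) (∑-*ʳ _ K (allZ2 u)))) (∑-*ʳ _ K (allZ2 u)) ⟩
  2 ^ b * (∑[ x ∈ allZ2 u ] 𝟙 (x == zeroV u) * K) + ∑[ x ∈ allZ2 u ] 𝟙 (S x) * K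
    ≡⟨ cong (λ n → 2 ^ b * (n * K) + ∑[ x ∈ allZ2 u ] 𝟙 (S x) * K) (∑-point u (zeroV u)) ⟩
  2 ^ b * (1 * K) + ∑[ x ∈ allZ2 u ] 𝟙 (S x) * K
    ≤⟨ +-monoʳ-≤ (2 ^ b * (1 * K)) (*-monoˡ-≤ K |S|≤2^b) ⟩
  2 ^ b * (1 * K) + 2 ^ b * K
    ≡⟨ +-comm (2 ^ b * (1 * K)) (2 ^ b * K) ⟩
  2 ^ b * K + 2 ^ b * (1 * K)
    ≡⟨ sym (*-distribˡ-+ (2 ^ b) K (1 * K)) ⟩
  2 ^ b * (2 * K)
    ∎
  where
  open ≤-Reasoning
  K = length (allLin u b)

theorem3 : Σ ℕ (λ C → (b u : ℕ) → (S : Subset2 u) → IsSubspaceOfDim S b → sumL u b S ≤ C * length (allLin u b))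
theorem3 = 2 , bound
  where
  bound : (b u : ℕ) → (S : Subset2 u) → IsSubspaceOfDim S b → sumL u b S ≤ 2 * length (allLin u b)
  bound b u S (sub , B , basis) = *-cancelˡ-≤ (2 ^ b) {{m^n≢0 2 b}} (begin
    2 ^ b * sumL u b S                                   ≤⟨ *-monoʳ-≤ (2 ^ b) (sumL≤∑killers u b S sub) ⟩
    2 ^ b * ∑[ x ∈ allZ2 u ] (𝟙 (S x) * killers u b x)   ≤⟨ scaled-∑killers-bound u b S (subspace-size S B basis) ⟩
    2 ^ b * (2 * length (allLin u b))                    ∎)
    where open ≤-Reasoning
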